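{- Let $\mathcal A$ be a triangular matrix interpretation, let $M$ be the component-wise maximum of all matrices occurring in $\mathcal A$, and let $d$ be the number of ones on the diagonal of $M$. Then $\mathcal A$ is of degree $d$.
   Context: A matrix interpretation $\mathcal A$ of dimension $k$ assigns to each $n$-ary symbol $f$ of a finite signature a map $f_{\mathcal A}(\vec v_1,\dots,\vec v_n)=F_1\vec v_1+\dots+F_n\vec v_n+\vec f$ with $F_i\in\mathbb N^{k\times k}$, $\vec f\in\mathbb N^k$. An upper triangular complexity matrix is $M\in\mathbb N^{k\times k}$ with $M_{j,l}=0$ for $l<j$ and $M_{j,j}\le1$. $\mathcal A$ is a triangular matrix interpretation (TMI) if all matrices used are upper triangular complexity matrices. $[t]$ is the evaluation of $t$ with all variables mapped to $\vec 0$, $[t]_j$ its $j$-th component; $|t|$ the number of symbol and variable occurrences in $t$. $\mathcal A$ is of degree $d$ if there is a constant $c$ with $[t]_j\le c\cdot|t|^d$ for all terms $t$ and all $1\le j\le k$. -}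

module Defs where

open import Data.Nat using (ℕ; zero; suc; _+_; _*_; _^_; _≤_; _<_; _⊔_; _≡ᵇ_)
open import Data.Fin using (Fin; toℕ) renaming (zero to fzero; suc to fsuc)
open import Data.Bool using (if_then_else_)
open import Data.Product using (∃)
open import Relation.Binary.PropositionalEquality using (_≡_)

sumFin : (n : ℕ) → (Fin n → ℕ) → ℕ
sumFin zero    g = 0
sumFin (suc n) g = g fzero + sumFin n (λ i → g (fsuc i))

maxFin : (n : ℕ) → (Fin n → ℕ) → ℕ
maxFin zero    g = 0
maxFin (suc n) g = g fzero ⊔ maxFin n (λ i → g (fsuc i))

data Term (s : ℕ) (ar : Fin s → ℕ) : Set where
  var : ℕ → Term s ar
  app : (f : Fin s) → (Fin (ar f) → Term s ar) → Term s ar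

size : ∀ {s ar} → Term s ar → ℕ
size (var _)    = 1
size (app f ts) = suc (sumFin _ (λ i → size (ts i)))

Vector : ℕ → Set
Vector k = Fin k → ℕ

Matrix : ℕ → Set
Matrix k = Fin k → Fin k → ℕ

_·_ : ∀ {k} → Matrix k → Vector k → Vector k
_·_ {k} M v j = sumFin k (λ l → M j l * v l)

-- Matrix interpretation of dimension k: f(v₁..vₙ) = F₁v₁ + ... + Fₙvₙ + f⃗.
record MatrixInterpretation (s : ℕ) (ar : Fin s → ℕ) (k : ℕ) : Set where
  field
    mat : (f : Fin s) → Fin (ar f) → Matrix k
    cst : (f : Fin s) → Vector k
open MatrixInterpretation public

eval : ∀ {s ar k} → MatrixInterpretation s ar k → Term s ar → Vector k
eval A (var _)    j = 0
eval A (app f ts) j = sumFin _ (λ i → (mat A f i · eval A (ts i)) j) + cst A f j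

IsUTCM : ∀ {k} → Matrix k → Set
IsUTCM {k} M = (∀ (j l : Fin k) → toℕ l < toℕ j → M j l ≡ 0) × (∀ (j : Fin k) → M j j ≤ 1)
  where open import Data.Product using (_×_)

IsTMI : ∀ {s ar k} → MatrixInterpretation s ar k → Set
IsTMI {s} {ar} A = ∀ (f : Fin s) (i : Fin (ar f)) → IsUTCM (mat A f i)

-- Component-wise maximum of all matrices occurring in A (zero matrix if none).
maxMatrix : ∀ {s ar k} → MatrixInterpretation s ar k → Matrix k
maxMatrix {s} {ar} A j l = maxFin s (λ f → maxFin (ar f) (λ i → mat A f i j l))

diagOnes : ∀ {k} → Matrix k → ℕ
diagOnes {k} M = sumFin k (λ j → if M j j ≡ᵇ 1 then 1 else 0)

IsOfDegree : ∀ {s ar k} → MatrixInterpretation s ar k → ℕ → Set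
IsOfDegree {s} {ar} {k} A d =
  ∃ λ (c : ℕ) → ∀ (t : Term s ar) (j : Fin k) → eval A t j ≤ c * (size t ^ d)

-- Induction on the dimension k.  Components 2..k of a triangular interpretation
-- form a triangular interpretation of dimension k − 1, bounded by C·|t|^d' with
-- d' the diagonal ones of its maximum matrix.  For the first component,
--   [f(t₁..tₙ)]₁ ≤ M₁₁ · Σᵢ [tᵢ]₁ + B·|f(t₁..tₙ)|^d',
-- since the remaining entries of the first row only see components 2..k.  If
-- M₁₁ = 0 this is already a bound of degree d'; if M₁₁ = 1 unfolding the
-- recurrence costs one more power of |t|, because x ↦ x^(d'+1) is superadditive.
module Submission where

open import Defs
open import Data.Nat
open import Data.Nat.Properties
open import Data.Nat.Solver using (module +-*-Solver)
open import Data.Fin using (Fin) renaming (zero to fzero; suc to fsuc)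
open import Data.Bool using (if_then_else_)
open import Data.Product using (_,_; proj₁; proj₂)
open import Function using (_∘_)
open import Relation.Binary.PropositionalEquality

open +-*-Solver

sumFin-cong : ∀ n {g h : Fin n → ℕ} → (∀ i → g i ≡ h i) → sumFin n g ≡ sumFin n h
sumFin-cong zero    g≗h = refl
sumFin-cong (suc n) g≗h = cong₂ _+_ (g≗h fzero) (sumFin-cong n (g≗h ∘ fsuc))

sumFin-mono-≤ : ∀ n {g h : Fin n → ℕ} → (∀ i → g i ≤ h i) → sumFin n g ≤ sumFin n h
sumFin-mono-≤ zero    g≤h = z≤n
sumFin-mono-≤ (suc n) g≤h = +-mono-≤ (g≤h fzero) (sumFin-mono-≤ n (g≤h ∘ fsuc))

≤-sumFin : ∀ n (g : Fin n → ℕ) i → g i ≤ sumFin n g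
≤-sumFin (suc n) g fzero    = m≤m+n _ _
≤-sumFin (suc n) g (fsuc i) = ≤-trans (≤-sumFin n (g ∘ fsuc) i) (m≤n+m _ _)

*-distribˡ-sumFin : ∀ n c (g : Fin n → ℕ) → sumFin n (λ i → c * g i) ≡ c * sumFin n g
*-distribˡ-sumFin zero    c g = sym (*-zeroʳ c)
*-distribˡ-sumFin (suc n) c g =
  trans (cong (c * g fzero +_) (*-distribˡ-sumFin n c (g ∘ fsuc)))
        (sym (*-distribˡ-+ c (g fzero) _))

sumFin-affine-≤ : ∀ n m c {g h : Fin n → ℕ} → (∀ i → g i ≤ m * h i + c) →
                  sumFin n g ≤ m * sumFin n h + n * c
sumFin-affine-≤ zero    m c g≤ = z≤n
sumFin-affine-≤ (suc n) m c {g} {h} g≤ = begin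
  g fzero + sumFin n (g ∘ fsuc)
    ≤⟨ +-mono-≤ (g≤ fzero) (sumFin-affine-≤ n m c (g≤ ∘ fsuc)) ⟩
  (m * h fzero + c) + (m * sumFin n (h ∘ fsuc) + n * c)
    ≡⟨ solve 5 (λ m c x y n → (m :* x :+ c) :+ (m :* y :+ n :* c)
                             := m :* (x :+ y) :+ (c :+ n :* c))
             refl m c (h fzero) (sumFin n (h ∘ fsuc)) n ⟩
  m * (h fzero + sumFin n (h ∘ fsuc)) + (c + n * c) ∎
  where open ≤-Reasoning

≤-maxFin : ∀ n (g : Fin n → ℕ) i → g i ≤ maxFin n g
≤-maxFin (suc n) g fzero    = m≤m⊔n _ _
≤-maxFin (suc n) g (fsuc i) = ≤-trans (≤-maxFin n (g ∘ fsuc) i) (m≤n⊔m _ _)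

maxFin-lub : ∀ n {g : Fin n → ℕ} x → (∀ i → g i ≤ x) → maxFin n g ≤ x
maxFin-lub zero    x g≤x = z≤n
maxFin-lub (suc n) x g≤x = ⊔-lub (g≤x fzero) (maxFin-lub n x (g≤x ∘ fsuc))

^-superadditive : ∀ a b p → a ^ suc p + b ^ suc p ≤ (a + b) ^ suc p
^-superadditive a b p = begin
  a * a ^ p + b * b ^ p
    ≤⟨ +-mono-≤ (*-monoʳ-≤ a (^-monoˡ-≤ p (m≤m+n a b)))
                (*-monoʳ-≤ b (^-monoˡ-≤ p (m≤n+m b a))) ⟩
  a * (a + b) ^ p + b * (a + b) ^ p
    ≡⟨ *-distribʳ-+ ((a + b) ^ p) a b ⟨
  (a + b) * (a + b) ^ p ∎
  where open ≤-Reasoning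

sumFin-^-≤ : ∀ n (g : Fin n → ℕ) p → sumFin n (λ i → g i ^ suc p) ≤ sumFin n g ^ suc p
sumFin-^-≤ zero    g p = z≤n
sumFin-^-≤ (suc n) g p =
  ≤-trans (+-monoʳ-≤ (g fzero ^ suc p) (sumFin-^-≤ n (g ∘ fsuc) p))
          (^-superadditive (g fzero) _ p)

n^[1+p]+[1+n]^p≤[1+n]^[1+p] : ∀ n p → n ^ suc p + suc n ^ p ≤ suc n ^ suc p
n^[1+p]+[1+n]^p≤[1+n]^[1+p] n p = begin
  n * n ^ p + suc n ^ p       ≤⟨ +-monoˡ-≤ (suc n ^ p) (*-monoʳ-≤ n (^-monoˡ-≤ p (n≤1+n n))) ⟩
  n * suc n ^ p + suc n ^ p   ≡⟨ +-comm (n * suc n ^ p) (suc n ^ p) ⟩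
  suc n * suc n ^ p           ∎
  where open ≤-Reasoning

module _ {s : ℕ} {ar : Fin s → ℕ} where

  size-nonZero : (t : Term s ar) → NonZero (size t)
  size-nonZero (var _)   = _
  size-nonZero (app _ _) = _

  size^-monoʳ-≤ : (t : Term s ar) {p q : ℕ} → p ≤ q → size t ^ p ≤ size t ^ q
  size^-monoʳ-≤ t = ^-monoʳ-≤ (size t) {{size-nonZero t}}

  size-subterm : ∀ f (ts : Fin (ar f) → Term s ar) i → size (ts i) ≤ size (app f ts)
  size-subterm f ts i = ≤-trans (≤-sumFin (ar f) (size ∘ ts) i) (n≤1+n _)

  recurrence-bound : (h : Term s ar → ℕ) {m : ℕ} (B p : ℕ) → m ≤ 1 →
    (∀ x → h (var x) ≡ 0) →
    (∀ f ts → h (app f ts) ≤ m * sumFin (ar f) (h ∘ ts) + B * size (app f ts) ^ p) →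
    ∀ t → h t ≤ B * size t ^ (m + p)
  recurrence-bound h B p m≤1 h-var h-app (var x) = ≤-trans (≤-reflexive (h-var x)) z≤n
  recurrence-bound h B p z≤n h-var h-app (app f ts) = h-app f ts
  recurrence-bound h B p (s≤s z≤n) h-var h-app (app f ts) = begin
    h (app f ts)
      ≤⟨ h-app f ts ⟩
    1 * sumFin (ar f) (h ∘ ts) + B * suc S ^ p
      ≡⟨ cong (_+ B * suc S ^ p) (*-identityˡ _) ⟩
    sumFin (ar f) (h ∘ ts) + B * suc S ^ p
      ≤⟨ +-monoˡ-≤ (B * suc S ^ p) subterms-bound ⟩
    B * S ^ suc p + B * suc S ^ p
      ≡⟨ *-distribˡ-+ B (S ^ suc p) (suc S ^ p) ⟨
    B * (S ^ suc p + suc S ^ p)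
      ≤⟨ *-monoʳ-≤ B (n^[1+p]+[1+n]^p≤[1+n]^[1+p] S p) ⟩
    B * suc S ^ suc p ∎
    where
      open ≤-Reasoning
      S = sumFin (ar f) (size ∘ ts)
      subterms-bound : sumFin (ar f) (h ∘ ts) ≤ B * S ^ suc p
      subterms-bound = begin
        sumFin (ar f) (h ∘ ts)
          ≤⟨ sumFin-mono-≤ (ar f) (λ i → recurrence-bound h B p (s≤s z≤n) h-var h-app (ts i)) ⟩
        sumFin (ar f) (λ i → B * size (ts i) ^ suc p)
          ≡⟨ *-distribˡ-sumFin (ar f) B (λ i → size (ts i) ^ suc p) ⟩
        B * sumFin (ar f) (λ i → size (ts i) ^ suc p)
          ≤⟨ *-monoʳ-≤ B (sumFin-^-≤ (ar f) (size ∘ ts) p) ⟩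
        B * S ^ suc p ∎

  tailᴵ : ∀ {k} → MatrixInterpretation s ar (suc k) → MatrixInterpretation s ar k
  tailᴵ A = record
    { mat = λ f i j l → mat A f i (fsuc j) (fsuc l)
    ; cst = λ f j → cst A f (fsuc j)
    }

  tailᴵ-isTMI : ∀ {k} (A : MatrixInterpretation s ar (suc k)) → IsTMI A → IsTMI (tailᴵ A)
  tailᴵ-isTMI A tri f i =
    (λ j l l<j → proj₁ (tri f i) (fsuc j) (fsuc l) (s≤s l<j)) , (λ j → proj₂ (tri f i) (fsuc j))

  eval-tailᴵ : ∀ {k} (A : MatrixInterpretation s ar (suc k)) → IsTMI A →
               ∀ t j → eval A t (fsuc j) ≡ eval (tailᴵ A) t j
  eval-tailᴵ A tri (var _)    j = refl
  eval-tailᴵ {k} A tri (app f ts) j =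
    cong (_+ cst A f (fsuc j)) (sumFin-cong (ar f) (λ i →
      cong₂ _+_ (cong (_* eval A (ts i) fzero) (proj₁ (tri f i) (fsuc j) fzero (s≤s z≤n)))
                (sumFin-cong k (λ l → cong (mat A f i (fsuc j) (fsuc l) *_)
                                           (eval-tailᴵ A tri (ts i) l)))))

  mat≤maxMatrix : ∀ {k} (A : MatrixInterpretation s ar k) f i j l → mat A f i j l ≤ maxMatrix A j l
  mat≤maxMatrix A f i j l =
    ≤-trans (≤-maxFin (ar f) (λ i → mat A f i j l) i)
            (≤-maxFin s (λ f → maxFin (ar f) (λ i → mat A f i j l)) f)

  maxMatrix-diag≤1 : ∀ {k} (A : MatrixInterpretation s ar k) → IsTMI A → ∀ j → maxMatrix A j j ≤ 1
  maxMatrix-diag≤1 A tri j = maxFin-lub s 1 (λ f → maxFin-lub (ar f) 1 (λ i → proj₂ (tri f i) j))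

  diagOnes-maxMatrix-suc : ∀ {k} (A : MatrixInterpretation s ar (suc k)) → IsTMI A →
    diagOnes (maxMatrix A) ≡ maxMatrix A fzero fzero + diagOnes (maxMatrix (tailᴵ A))
  diagOnes-maxMatrix-suc A tri = cong (_+ diagOnes (maxMatrix (tailᴵ A)))
                                      (indicator≡ (maxMatrix-diag≤1 A tri fzero))
    where
      indicator≡ : ∀ {m} → m ≤ 1 → (if m ≡ᵇ 1 then 1 else 0) ≡ m
      indicator≡ z≤n       = refl
      indicator≡ (s≤s z≤n) = refl

  module FirstComponent {k} (A : MatrixInterpretation s ar (suc k)) {C d : ℕ}
           (tail-bound : ∀ t j → eval A t (fsuc j) ≤ C * size t ^ d) where

    m₀ R B : ℕ
    m₀ = maxMatrix A fzero fzero
    R  = sumFin k (maxMatrix A fzero ∘ fsuc)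
    B  = maxFin s ar * (C * R) + maxFin s (λ f → cst A f fzero)

    row-bound : ∀ f ts i → (mat A f i · eval A (ts i)) fzero ≤
                m₀ * eval A (ts i) fzero + C * size (app f ts) ^ d * R
    row-bound f ts i = +-mono-≤ (*-monoˡ-≤ _ (mat≤maxMatrix A f i fzero fzero)) (begin
      sumFin k (λ l → mat A f i fzero (fsuc l) * eval A (ts i) (fsuc l))
        ≤⟨ sumFin-mono-≤ k entry-bound ⟩
      sumFin k (λ l → X * maxMatrix A fzero (fsuc l))
        ≡⟨ *-distribˡ-sumFin k X (maxMatrix A fzero ∘ fsuc) ⟩
      X * R ∎)
      where
        open ≤-Reasoning
        X = C * size (app f ts) ^ d
        entry-bound : ∀ l → mat A f i fzero (fsuc l) * eval A (ts i) (fsuc l) ≤ X * maxMatrix A fzero (fsuc l)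
        entry-bound l = ≤-trans
          (*-mono-≤ (mat≤maxMatrix A f i fzero (fsuc l))
                    (≤-trans (tail-bound (ts i) l) (*-monoʳ-≤ C (^-monoˡ-≤ d (size-subterm f ts i)))))
          (≤-reflexive (*-comm _ X))

    eval-app-fzero-≤ : ∀ f ts → eval A (app f ts) fzero ≤
      m₀ * sumFin (ar f) (λ i → eval A (ts i) fzero) + B * size (app f ts) ^ d
    eval-app-fzero-≤ f ts = begin
      sumFin (ar f) (λ i → (mat A f i · eval A (ts i)) fzero) + cst A f fzero
        ≤⟨ +-mono-≤ (sumFin-affine-≤ (ar f) m₀ (C * P * R) (row-bound f ts)) cst-bound ⟩
      m₀ * Σ₀ + ar f * (C * P * R) + K * P
        ≤⟨ +-monoˡ-≤ (K * P) (+-monoʳ-≤ (m₀ * Σ₀) (*-monoˡ-≤ (C * P * R) (≤-maxFin s ar f))) ⟩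
      m₀ * Σ₀ + a * (C * P * R) + K * P
        ≡⟨ solve 6 (λ x a C P R K → x :+ a :* (C :* P :* R) :+ K :* P
                                   := x :+ (a :* (C :* R) :+ K) :* P)
                 refl (m₀ * Σ₀) a C P R K ⟩
      m₀ * Σ₀ + B * P ∎
      where
        open ≤-Reasoning
        P  = size (app f ts) ^ d
        Σ₀ = sumFin (ar f) (λ i → eval A (ts i) fzero)
        a  = maxFin s ar
        K  = maxFin s (λ f → cst A f fzero)
        cst-bound : cst A f fzero ≤ K * P
        cst-bound = begin
          cst A f fzero ≤⟨ ≤-maxFin s (λ f → cst A f fzero) f ⟩
          K             ≡⟨ *-identityʳ K ⟨
          K * 1         ≤⟨ *-monoʳ-≤ K (size^-monoʳ-≤ (app f ts) {0} {d} z≤n) ⟩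
          K * P         ∎

  tmi-degree : ∀ k (A : MatrixInterpretation s ar k) → IsTMI A → IsOfDegree A (diagOnes (maxMatrix A))
  tmi-degree zero    A tri = 0 , λ _ ()
  tmi-degree (suc k) A tri with tmi-degree k (tailᴵ A) (tailᴵ-isTMI A tri)
  ... | C , tailᴵ-bound =
    C + B , subst (λ e → ∀ t j → eval A t j ≤ (C + B) * size t ^ e)
                  (sym (diagOnes-maxMatrix-suc A tri)) bound
    where
      d = diagOnes (maxMatrix (tailᴵ A))
      tail-bound : ∀ t j → eval A t (fsuc j) ≤ C * size t ^ d
      tail-bound t j = ≤-trans (≤-reflexive (eval-tailᴵ A tri t j)) (tailᴵ-bound t j)
      open FirstComponent A {C} {d} tail-bound
      bound : ∀ t j → eval A t j ≤ (C + B) * size t ^ (m₀ + d)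
      bound t fzero    = ≤-trans
        (recurrence-bound (λ t → eval A t fzero) B d (maxMatrix-diag≤1 A tri fzero)
                          (λ _ → refl) eval-app-fzero-≤ t)
        (*-monoˡ-≤ _ (m≤n+m B C))
      bound t (fsuc j) = ≤-trans (tail-bound t j)
        (*-mono-≤ (m≤m+n C B) (size^-monoʳ-≤ t (m≤n+m d m₀)))

lemma7 : (s : ℕ) (ar : Fin s → ℕ) (k : ℕ) (A : MatrixInterpretation s ar k) →
         IsTMI A → IsOfDegree A (diagOnes (maxMatrix A))
lemma7 s ar = tmi-degree
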